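{- Let $\gamma\colon X\to CX$ and $\delta\colon Y\to CY$ be cellular automata, $\rho\colon Q\to CQ$ a cellular automaton, and $q_1\colon\rho\to\gamma$, $q_2\colon\rho\to\delta$ pre-cellular morphisms. Let $\mathrm{Cons}=\{(c_1,c_2)\in X^*\times Y^*: c_1\circ q_1=c_2\circ q_2\}$ with projections $\pi_1\colon\mathrm{Cons}\to X^*$, $\pi_2\colon\mathrm{Cons}\to Y^*$ and $g_{\mathrm{Cons}}(c_1,c_2)=(G_\gamma(c_1),G_\delta(c_2))$. Then for every cellular bisimulation $(\rho,q,R,p,g)$ (with the same $\rho,q_1,q_2$) there is a unique map $h\colon R\to\mathrm{Cons}$ with $\pi_k\circ h=p_k$ for $k=1,2$, and this map satisfies $h\circ g=g_{\mathrm{Cons}}\circ h$. (Moreover $(\rho,q,\mathrm{Cons},\pi,g_{\mathrm{Cons}})$ is itself a cellular bisimulation, so it is final among cellular bisimulations extending $(\rho,q)$.)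
   Context: Fix a monoid $(M,\cdot,e)$, a subset $N\subseteq M$ with inclusion $i\colon N\hookrightarrow M$, and a set $S$ of states. $[A,B]$ is the set of maps $A\to B$. For $a\colon M\to X$ let $I^a\subseteq[N,S]$ be the set of $f\colon N\to S$ with $f(n)=f(n')$ whenever $a(i(n))=a(i(n'))$; for $h\colon X\to Y$, $I^{h\circ a}\subseteq I^a$. Let $CX=\coprod_{a\colon M\to X}[I^a,S]$, $(Ch)(a,f)=(h\circ a, f|_{I^{h\circ a}})$. A cellular automaton is $\gamma\colon X\to CX$, $\gamma(x)=(\gamma_1(x),\gamma_2(x))$ with $\gamma_1(x)\colon M\to X$, $\gamma_2(x)\colon I^{\gamma_1(x)}\to S$, such that $\gamma_1(x)(e)=x$ and $\gamma_1(\gamma_1(x)(m))(n)=\gamma_1(x)(n\cdot m)$. A pre-cellular morphism $h\colon\gamma\to\delta$ is a map with $Ch\circ\gamma=\delta\circ h$. Configurations $X^*=[X,S]$; $h^*(c)=c\circ h$. Global rule $G_\gamma(c)(x)=\gamma_2(x)(c\circ\gamma_1(x)\circ i)$. A cellular bisimulation between $\gamma$ and $\delta$ is a tuple $(\rho,q,R,p,g)$: a cellular automaton $\rho\colon Q\to CQ$, pre-cellular morphisms $q_1\colon\rho\to\gamma$, $q_2\colon\rho\to\delta$, a set $R$ with maps $p_1\colon R\to X^*$, $p_2\colon R\to Y^*$, and $g\colon R\to R$, such that $q_1^*\circ p_1=q_2^*\circ p_2$, $p_1\circ g=G_\gamma\circ p_1$ and $p_2\circ g=G_\delta\circ p_2$.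 -}

module Defs where

open import Data.Product using (Σ; _×_; _,_; proj₁; proj₂)
open import Function using (_∘_)
open import Relation.Binary.PropositionalEquality using (_≡_; cong)

-- Everything is relative to the fixed data of the paper:
-- a carrier M with multiplication _·_ and unit e (the monoid laws are
-- hypotheses of the theorem), a "subset" N given by a map i : N → M
-- (its injectivity is a hypothesis of the theorem), and a set S of states.
module Framework (M : Set) (_·_ : M → M → M) (e : M)
                 (N : Set) (i : N → M) (S : Set) where

  I : {X : Set} → (M → X) → Set
  I a = Σ (N → S) λ f → ∀ n n' → a (i n) ≡ a (i n') → f n ≡ f n'

  incl : {X Y : Set} (h : X → Y) (a : M → X) → I (h ∘ a) → I a
  incl h a (f , r) = f , λ n n' eq → r n n' (cong h eq)

  C : Set → Set
  C X = Σ (M → X) λ a → I a → S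

  Cmap : {X Y : Set} → (X → Y) → C X → C Y
  Cmap h (a , f) = h ∘ a , f ∘ incl h a

  record CA (X : Set) : Set where
    field
      γ    : X → C X
      unit : ∀ x → proj₁ (γ x) e ≡ x
      comp : ∀ x m n → proj₁ (γ (proj₁ (γ x) m)) n ≡ proj₁ (γ x) (n · m)

    γ₁ : X → M → X
    γ₁ x = proj₁ (γ x)

    γ₂ : (x : X) → I (γ₁ x) → S
    γ₂ x = proj₂ (γ x)

  open CA public

  PreCellular : {X Y : Set} → CA X → CA Y → (X → Y) → Set
  PreCellular γ' δ' h = Cmap h ∘ CA.γ γ' ≡ CA.γ δ' ∘ h

  Conf : Set → Set
  Conf X = X → S

  _* : {X Y : Set} → (X → Y) → Conf Y → Conf X
  (h *) c = c ∘ h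

  G : {X : Set} → CA X → Conf X → Conf X
  G γ' c x = γ₂ γ' x (c ∘ γ₁ γ' x ∘ i , λ n n' eq → cong c eq)

  -- the conditions on (R, p₁, p₂, g) making (ρ, q, R, p, g) a cellular
  -- bisimulation between γ and δ (that ρ is a cellular automaton and the
  -- q_k are pre-cellular morphisms is assumed separately)
  IsCellularBisim : {X Y Q R : Set} → CA X → CA Y → (Q → X) → (Q → Y) →
                    (R → Conf X) → (R → Conf Y) → (R → R) → Set
  IsCellularBisim γ' δ' q₁ q₂ p₁ p₂ g =
    ((q₁ *) ∘ p₁ ≡ (q₂ *) ∘ p₂) × (p₁ ∘ g ≡ G γ' ∘ p₁) × (p₂ ∘ g ≡ G δ' ∘ p₂)

  Cons : {X Y Q : Set} → (Q → X) → (Q → Y) → Set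
  Cons {X} {Y} q₁ q₂ = Σ (Conf X × Conf Y) λ c → proj₁ c ∘ q₁ ≡ proj₂ c ∘ q₂

  π₁ : {X Y Q : Set} {q₁ : Q → X} {q₂ : Q → Y} → Cons q₁ q₂ → Conf X
  π₁ c = proj₁ (proj₁ c)

  π₂ : {X Y Q : Set} {q₁ : Q → X} {q₂ : Q → Y} → Cons q₁ q₂ → Conf Y
  π₂ c = proj₂ (proj₁ c)

  gCons₀ : {X Y : Set} → CA X → CA Y → Conf X × Conf Y → Conf X × Conf Y
  gCons₀ γ' δ' (c₁ , c₂) = G γ' c₁ , G δ' c₂

  ConsClosed : {X Y Q : Set} → CA X → CA Y → (q₁ : Q → X) → (q₂ : Q → Y) → Set
  ConsClosed γ' δ' q₁ q₂ =
    (c : Cons q₁ q₂) → let d = gCons₀ γ' δ' (proj₁ c) in proj₁ d ∘ q₁ ≡ proj₂ d ∘ q₂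

  gCons : {X Y Q : Set} (γ' : CA X) (δ' : CA Y) {q₁ : Q → X} {q₂ : Q → Y} →
          ConsClosed γ' δ' q₁ q₂ → Cons q₁ q₂ → Cons q₁ q₂
  gCons γ' δ' cl c = gCons₀ γ' δ' (proj₁ c) , cl c

{-# OPTIONS --safe #-}
module Submission where

-- Pre-cellular morphisms q : ρ → η intertwine the global rules with pullback,
-- q* ∘ G_η = G_ρ ∘ q*, because G is evaluation of the local rule and C q only
-- restricts the local rule.  Hence g_Cons maps Cons to itself, and Cons, being
-- a subset of X* × Y*, admits exactly one map ⟨p₁ , p₂⟩ from R over X* and Y*;
-- that map intertwines g and g_Cons since both sides have the same projections.

open import Defs
open import Level using (0ℓ)
open import Axiom.Extensionality.Propositional using (Extensionality)
open import Axiom.UniquenessOfIdentityProofs.WithK using (uip)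
open import Algebra.Structures using (IsMonoid)
open import Function using (_∘_)
open import Function.Definitions using (Injective)
open import Data.Product using (Σ; ∃; _×_; _,_; proj₂)
open import Data.Product.Properties using (Σ-≡,≡→≡; ×-≡,≡→≡)
open import Relation.Binary.PropositionalEquality
  using (_≡_; refl; sym; trans; cong; cong-app; module ≡-Reasoning)
open import Relation.Binary.PropositionalEquality.Properties using (cong-∘)

module CellularBisimulation (ext : Extensionality 0ℓ 0ℓ)
                            (M : Set) (_·_ : M → M → M) (e : M)
                            (N : Set) (i : N → M) (S : Set) where

  open Framework M _·_ e N i S

  evalLocal : {Z : Set} → Conf Z → C Z → S
  evalLocal c (a , f) = f (c ∘ a ∘ i , λ n n' eq → cong c eq)

  evalLocal-Cmap : {Z W : Set} (h : Z → W) (c : Conf W) (w : C Z) →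
                   evalLocal c (Cmap h w) ≡ evalLocal ((h *) c) w
  evalLocal-Cmap h c (a , f) =
    cong (λ r → f (c ∘ h ∘ a ∘ i , r))
         (ext λ n → ext λ n' → ext λ eq → sym (cong-∘ eq))

  *-G-comm : {Z W : Set} (ρ : CA Z) (η : CA W) {h : Z → W} →
             PreCellular ρ η h → (c : Conf W) → (h *) (G η c) ≡ G ρ ((h *) c)
  *-G-comm ρ η {h} pc c = ext λ z → begin
    G η c (h z)                        ≡⟨⟩
    evalLocal c (CA.γ η (h z))         ≡⟨ cong (evalLocal c) (sym (cong-app pc z)) ⟩
    evalLocal c (Cmap h (CA.γ ρ z))    ≡⟨ evalLocal-Cmap h c (CA.γ ρ z) ⟩
    evalLocal ((h *) c) (CA.γ ρ z)     ∎
    where open ≡-Reasoning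

  Cons-closed : {X Y Q : Set} (γ : CA X) (δ : CA Y) (ρ : CA Q)
                {q₁ : Q → X} {q₂ : Q → Y} →
                PreCellular ρ γ q₁ → PreCellular ρ δ q₂ → ConsClosed γ δ q₁ q₂
  Cons-closed γ δ ρ pc₁ pc₂ ((c₁ , c₂) , c₁q₁≡c₂q₂) =
    trans (*-G-comm ρ γ pc₁ c₁)
          (trans (cong (G ρ) c₁q₁≡c₂q₂) (sym (*-G-comm ρ δ pc₂ c₂)))

  Cons-bisim : {X Y Q : Set} (γ : CA X) (δ : CA Y) {q₁ : Q → X} {q₂ : Q → Y}
               (cl : ConsClosed γ δ q₁ q₂) →
               IsCellularBisim γ δ q₁ q₂ π₁ π₂ (gCons γ δ cl)
  Cons-bisim γ δ cl = ext proj₂ , refl , refl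

  ⟨_,_⟩ : {X Y Q R : Set} {q₁ : Q → X} {q₂ : Q → Y}
          (p₁ : R → Conf X) (p₂ : R → Conf Y) →
          (q₁ *) ∘ p₁ ≡ (q₂ *) ∘ p₂ → R → Cons q₁ q₂
  ⟨ p₁ , p₂ ⟩ E r = (p₁ r , p₂ r) , cong-app E r

  -- Needs uip (K): points of Cons carry equality proofs between configurations.
  Cons-jointly-monic : {X Y Q R : Set} {q₁ : Q → X} {q₂ : Q → Y}
                       (h h' : R → Cons q₁ q₂) →
                       π₁ ∘ h ≡ π₁ ∘ h' → π₂ ∘ h ≡ π₂ ∘ h' → h ≡ h'
  Cons-jointly-monic h h' e₁ e₂ = ext λ r →
    Σ-≡,≡→≡ (×-≡,≡→≡ (cong-app e₁ r , cong-app e₂ r) , uip _ _)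

proposition2 : Extensionality 0ℓ 0ℓ →
    (M : Set) (_·_ : M → M → M) (e : M) → IsMonoid _≡_ _·_ e →
    (N : Set) (i : N → M) → Injective _≡_ _≡_ i → (S : Set) →
    let open Framework M _·_ e N i S in
    {X Y Q : Set} (γ : CA X) (δ : CA Y) (ρ : CA Q)
    (q₁ : Q → X) (q₂ : Q → Y) → PreCellular ρ γ q₁ → PreCellular ρ δ q₂ →
    Σ (ConsClosed γ δ q₁ q₂) λ cl →
      IsCellularBisim γ δ q₁ q₂ π₁ π₂ (gCons γ δ cl)
      × ((R : Set) (p₁ : R → Conf X) (p₂ : R → Conf Y) (g : R → R) →
         IsCellularBisim γ δ q₁ q₂ p₁ p₂ g →
         ∃ λ (h : R → Cons q₁ q₂) →
           ((π₁ ∘ h ≡ p₁) × (π₂ ∘ h ≡ p₂))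
           × (∀ (h' : R → Cons q₁ q₂) → (π₁ ∘ h' ≡ p₁) × (π₂ ∘ h' ≡ p₂) → h' ≡ h)
           × (h ∘ g ≡ gCons γ δ cl ∘ h))
proposition2 ext M _·_ e _ N i _ S γ δ ρ q₁ q₂ pc₁ pc₂ =
  cl , Cons-bisim γ δ cl ,
  λ { R p₁ p₂ g (E , p₁g≡Gp₁ , p₂g≡Gp₂) →
      ⟨ p₁ , p₂ ⟩ E , (refl , refl)
    , (λ h' (e₁ , e₂) → Cons-jointly-monic h' (⟨ p₁ , p₂ ⟩ E) e₁ e₂)
    , Cons-jointly-monic (⟨ p₁ , p₂ ⟩ E ∘ g) (gCons γ δ cl ∘ ⟨ p₁ , p₂ ⟩ E)
                         p₁g≡Gp₁ p₂g≡Gp₂ }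
  where
  open Framework M _·_ e N i S using (ConsClosed; gCons)
  open CellularBisimulation ext M _·_ e N i S

  cl : ConsClosed γ δ q₁ q₂
  cl = Cons-closed γ δ ρ pc₁ pc₂
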